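{- Fix an integer $c\ge1$. Then the worst-case ratio between $OPT_{c\text{ - }BLZ}({\bf s})$ and $OPT_{LZ}({\bf s})$ over ternary strings is unbounded: for every real $M$ there exists a nonempty string ${\bf s}\in\{1,2,3\}^*$ with $OPT_{c\text{ - }BLZ}({\bf s})/OPT_{LZ}({\bf s})>M$.
   Context: For ${\bf s}=s_1\dots s_N$, ${\bf s}[i,j]=s_i\dots s_j$. A parsing of ${\bf s}$ is a partition into consecutive nonempty substrings (phrases); its size is the number of phrases. An LZ-parsing is a parsing in which every phrase ${\bf s}[a,e]$ either has length $1$, or is given together with a chosen source start $b$ with $1\le b\le a-1$ and ${\bf s}[b,b+(e-a)-1]={\bf s}[a,e-1]$ (overlap allowed); each position $a+t$, $0\le t\le e-a-1$, then has source position $b+(t\bmod(a-b))$. The hop-number of position $p$ is $0$ if $p$ is the last position of a phrase and $hop(q)+1$ otherwise, where $q$ is the source position of $p$. A $c$-BLZ parsing is an LZ-parsing in which every hop-number is at most $c$. $OPT_{LZ}({\bf s})$ is the minimum size of an LZ-parsing of ${\bf s}$, and $OPT_{c\text{ - }BLZ}({\bf s})$ is the minimum size of a $c$-BLZ parsing of ${\bf s}$.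
   Formalization: The bound M ranges only over the rationals rather than over all reals. -}

module Defs where

open import Data.Nat using (ℕ; zero; suc; _+_; _∸_; _<_; _≤_; NonZero)
open import Data.Nat.DivMod using (_%_)
open import Data.List using (List; []; _∷_; length)
open import Data.Maybe using (Maybe; just; nothing)
open import Data.Product using (Σ; _×_; ∃)
open import Relation.Binary.PropositionalEquality using (_≡_)
open import Relation.Nullary using (¬_)

-- Positions are 0-indexed internally: paper position i is index i ∸ 1 here.

_at_ : {A : Set} → List A → ℕ → Maybe A
[] at _ = nothing
(x ∷ xs) at zero = just x
(x ∷ xs) at suc i = xs at i

record Phrase : Set where
  constructor phrase
  field
    len : ℕ
    src : Maybe ℕ
open Phrase public

-- Literal phrases (no source) have length 1; a copy phrase s[a, a+len-1]
-- with source b must satisfy b < a (i.e. 1 ≤ b ≤ a-1 in 1-indexing) and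
-- s[b + t] = s[a + t] for all t < len - 1 (i.e. s[b,b+(e-a)-1] = s[a,e-1]).
PhraseOK : {A : Set} → List A → ℕ → Phrase → Set
PhraseOK s a (phrase ℓ nothing)  = ℓ ≡ 1
PhraseOK s a (phrase ℓ (just b)) =
  (1 ≤ ℓ) × (b < a) × (∀ t → suc t < ℓ → s at (b + t) ≡ s at (a + t))

ValidFrom : {A : Set} → List A → ℕ → List Phrase → Set
ValidFrom s a []         = a ≡ length s
ValidFrom s a (ph ∷ ps) = PhraseOK s a ph × ValidFrom s (a + len ph) ps

IsLZ : {A : Set} → List A → List Phrase → Set
IsLZ s ps = ValidFrom s 0 ps

data IsLast : ℕ → List Phrase → ℕ → Set where
  here  : ∀ {a ph ps} → IsLast a (ph ∷ ps) (a + len ph ∸ 1)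
  there : ∀ {a ph ps p} → IsLast (a + len ph) ps p → IsLast a (ph ∷ ps) p

data SrcOf : ℕ → List Phrase → ℕ → ℕ → Set where
  here  : ∀ {a ℓ b ps t} .{{_ : NonZero (a ∸ b)}} → suc t < ℓ →
          SrcOf a (phrase ℓ (just b) ∷ ps) (a + t) (b + t % (a ∸ b))
  there : ∀ {a ph ps p q} → SrcOf (a + len ph) ps p q → SrcOf a (ph ∷ ps) p q

data Hop (ps : List Phrase) : ℕ → ℕ → Set where
  last : ∀ {p} → IsLast 0 ps p → Hop ps p 0
  step : ∀ {p q h} → ¬ IsLast 0 ps p → SrcOf 0 ps p q → Hop ps q h →
         Hop ps p (suc h)

IsBLZ : {A : Set} → ℕ → List A → List Phrase → Set
IsBLZ c s ps = IsLZ s ps × (∀ p h → p < length s → Hop ps p h → h ≤ c)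

IsMin : (ℕ → Set) → ℕ → Set
IsMin P n = P n × (∀ m → P m → n ≤ m)

IsOptLZ : {A : Set} → List A → ℕ → Set
IsOptLZ s = IsMin (λ n → Σ (List Phrase) λ ps → IsLZ s ps × length ps ≡ n)

IsOptBLZ : {A : Set} → ℕ → List A → ℕ → Set
IsOptBLZ c s = IsMin (λ n → Σ (List Phrase) λ ps → IsBLZ c s ps × length ps ≡ n)

{-# OPTIONS --safe #-}
module Submission where

-- The witness is the ruler word of length 2^K whose letter at position j ≥ 1 is v2 j mod 3, v2 being
-- the 2-adic valuation. As v2 (2^k + n) = v2 n for 0 < n < 2^k, each prefix of length 2^(k+1) is the
-- prefix of length 2^k followed by a copy of it (up to the last letter), so OPT_LZ ≤ K + 1.
-- The word is aperiodic: two factors at distance d > 0 agree on fewer than 6d positions, since within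
-- 5d steps some position of valuation v2 d is followed at distance d by one of valuation v2 d + 1.
-- Now take a parsing with z phrases. A run of positions of hop-number ≤ h + 1 meets each phrase in its
-- last position and an interior segment; inside a copy phrase at distance d from its source, interior
-- offset t copies from b + (t mod d), so by aperiodicity the segment splits into at most 6 blocks, each
-- mirroring a run of hop-number ≤ h. Hence runs of hop-number ≤ c have length below a polynomial of
-- degree c + 1 in z, and 2^K positions force OPT_(c-BLZ) to be exponential in K.
-- The optima exist constructively because there are finitely many candidate parsings and validity and
-- hop bounds are decidable.

open import Defs

module Parsings where

  open import Data.Nat
    using (ℕ; zero; suc; _+_; _∸_; _<_; _≤_; _≤?_; _<?_; _≟_; z≤n; s≤s; NonZero; ≢-nonZero⁻¹; >-nonZero)
  open import Data.Nat.Properties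
  open import Data.Nat.DivMod using (_%_; m%n<n)
  open import Data.Nat.Induction using (<-rec)
  open import Data.Nat.ListAction using (sum)
  open import Data.List using (List; []; _∷_; length; map; replicate)
  open import Data.List.Relation.Unary.All using (All; []; _∷_)
  open import Data.Maybe using (just; nothing)
  open import Data.Maybe.Properties using (≡-dec)
  open import Data.Product using (Σ; _×_; ∃; _,_; proj₁)
  open import Data.Sum using (_⊎_; inj₁; inj₂)
  open import Data.Empty using (⊥-elim)
  open import Relation.Binary.PropositionalEquality
  open import Relation.Binary.Definitions using (DecidableEquality)
  open import Relation.Nullary using (Dec; yes; no; ¬_; contradiction)
  open import Relation.Nullary.Decidable using (map′; _×-dec_; _⊎-dec_; _→-dec_; ¬?)

  least : {P : ℕ → Set} → (∀ n → Dec (P n)) → ∀ n → P n → Σ ℕ (IsMin P)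
  least {P} P? = <-rec (λ n → P n → Σ ℕ (IsMin P)) below
    where
    below : ∀ n → (∀ {m} → m < n → P m → Σ ℕ (IsMin P)) → P n → Σ ℕ (IsMin P)
    below n rec pn with anyUpTo? P? n
    ... | yes (m , m<n , pm) = rec m<n pm
    ... | no none = n , pn , λ m pm → ≮⇒≥ λ m<n → none (m , m<n , pm)

  nonZero-∸⇒< : ∀ a b → .{{NonZero (a ∸ b)}} → b < a
  nonZero-∸⇒< a b = m∸n≢0⇒n<m (≢-nonZero⁻¹ (a ∸ b))

  <⇒nonZero-∸ : ∀ {a b} → b < a → NonZero (a ∸ b)
  <⇒nonZero-∸ b<a = >-nonZero (m<n⇒0<n∸m b<a)

  SrcOf⇒< : ∀ {a ps p q} → SrcOf a ps p q → q < p
  SrcOf⇒< (here {a} {b = b} {t = t} _) = begin-strict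
    b + t % (a ∸ b) <⟨ +-monoʳ-< b (m%n<n t (a ∸ b)) ⟩
    b + (a ∸ b)     ≡⟨ m+[n∸m]≡n (<⇒≤ (nonZero-∸⇒< a b)) ⟩
    a               ≤⟨ m≤m+n a t ⟩
    a + t           ∎
    where open ≤-Reasoning
  SrcOf⇒< (there src) = SrcOf⇒< src

  IsLast? : ∀ a ps p → Dec (IsLast a ps p)
  IsLast? a [] p = no λ ()
  IsLast? a (ph ∷ ps) p with p ≟ a + len ph ∸ 1 | IsLast? (a + len ph) ps p
  ... | yes refl | _      = yes here
  ... | no _     | yes l  = yes (there l)
  ... | no p≢    | no ¬l  = no λ { here → p≢ refl ; (there l) → ¬l l }

  -- The `here` case of SrcOf, as a relation on p and q that can be decided.
  data CopiedFrom (a ℓ b : ℕ) : ℕ → ℕ → Set where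
    copied : ∀ {t} .{{_ : NonZero (a ∸ b)}} → suc t < ℓ →
             CopiedFrom a ℓ b (a + t) (b + t % (a ∸ b))

  CopiedFrom? : ∀ a ℓ b p q → Dec (CopiedFrom a ℓ b p q)
  CopiedFrom? a ℓ b p q with b <? a | a ≤? p
  ... | no b≮a | _ = no λ { (copied _) → b≮a (nonZero-∸⇒< a b) }
  ... | yes _  | no a≰p = no λ { (copied {t} _) → a≰p (m≤m+n a t) }
  ... | yes b<a | yes a≤p = decide (suc t <? ℓ) (q ≟ b + t % (a ∸ b))
    where
    instance
      _ : NonZero (a ∸ b)
      _ = <⇒nonZero-∸ b<a
    t = p ∸ a
    decide : Dec (suc t < ℓ) → Dec (q ≡ b + t % (a ∸ b)) → Dec (CopiedFrom a ℓ b p q)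
    decide (yes t+1<ℓ) (yes q≡) = yes (subst₂ (CopiedFrom a ℓ b) (m+[n∸m]≡n a≤p) (sym q≡) (copied t+1<ℓ))
    decide (no t+1≮ℓ) _ =
      no λ { (copied {t′} t′+1<ℓ) → t+1≮ℓ (subst (λ x → suc x < ℓ) (sym (m+n∸m≡n a t′)) t′+1<ℓ) }
    decide (yes _) (no q≢) =
      no λ { (copied {t′} _) → q≢ (cong (λ x → b + x % (a ∸ b)) (sym (m+n∸m≡n a t′))) }

  SrcOf? : ∀ a ps p q → Dec (SrcOf a ps p q)
  SrcOf? a [] p q = no λ ()
  SrcOf? a (phrase ℓ nothing ∷ ps) p q =
    map′ there (λ { (there src) → src }) (SrcOf? (a + ℓ) ps p q)
  SrcOf? a (phrase ℓ (just b) ∷ ps) p q with CopiedFrom? a ℓ b p q | SrcOf? (a + ℓ) ps p q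
  ... | yes (copied t<ℓ) | _        = yes (here t<ℓ)
  ... | no _             | yes src  = yes (there src)
  ... | no ¬c            | no ¬src  = no λ { (here t<ℓ) → ¬c (copied t<ℓ) ; (there src) → ¬src src }

  Hop? : ∀ ps p h → Dec (Hop ps p h)
  Hop? ps p zero = map′ last (λ { (last l) → l }) (IsLast? 0 ps p)
  Hop? ps p (suc h) with IsLast? 0 ps p
  ... | yes l = no λ { (step ¬l _ _) → ¬l l }
  ... | no ¬l with anyUpTo? (λ q → SrcOf? 0 ps p q ×-dec Hop? ps q h) p
  ...   | yes (_ , _ , src , hop) = yes (step ¬l src hop)
  ...   | no none = no λ { (step _ src hop) → none (_ , SrcOf⇒< src , src , hop) }

  Hop-descend : ∀ {ps p h k} → Hop ps p h → k ≤ h → ∃ λ q → q ≤ p × Hop ps q k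
  Hop-descend (last l) z≤n = _ , ≤-refl , last l
  Hop-descend {k = k} hop@(step {h = h} _ src hop′) k≤ with k ≟ suc h
  ... | yes refl = _ , ≤-refl , hop
  ... | no k≢ with Hop-descend hop′ (≤-pred (≤∧≢⇒< k≤ k≢))
  ...   | q , q≤ , hopq = q , ≤-trans q≤ (<⇒≤ (SrcOf⇒< src)) , hopq

  HopsBounded : ℕ → List Phrase → ℕ → Set
  HopsBounded c ps N = ∀ p h → p < N → Hop ps p h → h ≤ c

  HopsBounded? : ∀ c ps N → Dec (HopsBounded c ps N)
  HopsBounded? c ps N = map′ bounded unbounded (allUpTo? (λ p → ¬? (Hop? ps p (suc c))) N)
    where
    bounded : (∀ {p} → p < N → ¬ Hop ps p (suc c)) → HopsBounded c ps N
    bounded none p h p<N hop with h ≤? c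
    ... | yes h≤c = h≤c
    ... | no h≰c with Hop-descend hop (≰⇒> h≰c)
    ...   | q , q≤p , hopq = ⊥-elim (none (≤-<-trans q≤p p<N) hopq)
    unbounded : HopsBounded c ps N → ∀ {p} → p < N → ¬ Hop ps p (suc c)
    unbounded ok p<N hop = 1+n≰n (ok _ _ p<N hop)

  module _ {A : Set} (_≟A_ : DecidableEquality A) where

    PhraseOK? : ∀ (s : List A) a ph → Dec (PhraseOK s a ph)
    PhraseOK? s a (phrase ℓ nothing) = ℓ ≟ 1
    PhraseOK? s a (phrase ℓ (just b)) =
      (1 ≤? ℓ) ×-dec (b <? a) ×-dec
      map′ (λ agree t t<ℓ → agree {t} (<-trans (n<1+n t) t<ℓ) t<ℓ) (λ agree {t} _ → agree t)
           (allUpTo? (λ t → (suc t <? ℓ) →-dec ≡-dec _≟A_ (s at (b + t)) (s at (a + t))) ℓ)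

    ValidFrom? : ∀ (s : List A) a ps → Dec (ValidFrom s a ps)
    ValidFrom? s a []        = a ≟ length s
    ValidFrom? s a (ph ∷ ps) = PhraseOK? s a ph ×-dec ValidFrom? s (a + len ph) ps

  span : List Phrase → ℕ
  span ps = sum (map len ps)

  ValidFrom⇒span : ∀ {A : Set} {s : List A} {a} ps → ValidFrom s a ps → a + span ps ≡ length s
  ValidFrom⇒span {a = a} [] a≡ = trans (+-identityʳ a) a≡
  ValidFrom⇒span {a = a} (ph ∷ ps) (_ , valid) =
    trans (sym (+-assoc a (len ph) (span ps))) (ValidFrom⇒span ps valid)

  ValidFrom⇒≤ : ∀ {A : Set} {s : List A} {a} ps → ValidFrom s a ps → a ≤ length s
  ValidFrom⇒≤ {a = a} ps valid = ≤-trans (m≤m+n a (span ps)) (≤-reflexive (ValidFrom⇒span ps valid))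

  PhraseWithin : ℕ → Phrase → Set
  PhraseWithin N (phrase ℓ nothing)  = ℓ ≤ N
  PhraseWithin N (phrase ℓ (just b)) = ℓ ≤ N × b < N

  ValidFrom⇒within : ∀ {A : Set} {s : List A} {a} ps → ValidFrom s a ps → All (PhraseWithin (length s)) ps
  ValidFrom⇒within [] _ = []
  ValidFrom⇒within {s = s} {a} (phrase ℓ src ∷ ps) (ok , valid) = within src ok ∷ ValidFrom⇒within ps valid
    where
    a+ℓ≤N : a + ℓ ≤ length s
    a+ℓ≤N = ValidFrom⇒≤ ps valid
    within : ∀ src → PhraseOK s a (phrase ℓ src) → PhraseWithin (length s) (phrase ℓ src)
    within nothing  _             = ≤-trans (m≤n+m ℓ a) a+ℓ≤N
    within (just b) (_ , b<a , _) =
      ≤-trans (m≤n+m ℓ a) a+ℓ≤N , <-≤-trans b<a (≤-trans (m≤m+n a ℓ) a+ℓ≤N)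

  any-phrase? : ∀ N {R : Phrase → Set} → (∀ ph → Dec (R ph)) → Dec (∃ λ ph → PhraseWithin N ph × R ph)
  any-phrase? N {R} R? = map′ found unfound
    (anyUpTo? (λ ℓ → R? (phrase ℓ nothing) ⊎-dec anyUpTo? (λ b → R? (phrase ℓ (just b))) N) (suc N))
    where
    Candidate : ℕ → Set
    Candidate ℓ = R (phrase ℓ nothing) ⊎ ∃ λ b → b < N × R (phrase ℓ (just b))
    found : (∃ λ ℓ → ℓ < suc N × Candidate ℓ) → ∃ λ ph → PhraseWithin N ph × R ph
    found (ℓ , ℓ≤N , inj₁ r)           = phrase ℓ nothing , ≤-pred ℓ≤N , r
    found (ℓ , ℓ≤N , inj₂ (b , b<N , r)) = phrase ℓ (just b) , (≤-pred ℓ≤N , b<N) , r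
    unfound : (∃ λ ph → PhraseWithin N ph × R ph) → ∃ λ ℓ → ℓ < suc N × Candidate ℓ
    unfound (phrase ℓ nothing , ℓ≤N , r)         = ℓ , s≤s ℓ≤N , inj₁ r
    unfound (phrase ℓ (just b) , (ℓ≤N , b<N) , r) = ℓ , s≤s ℓ≤N , inj₂ (b , b<N , r)

  any-phrases? : ∀ N m {Q : List Phrase → Set} → (∀ ps → Dec (Q ps)) →
                 Dec (∃ λ ps → length ps ≡ m × All (PhraseWithin N) ps × Q ps)
  any-phrases? N zero Q? = map′ (λ q → [] , refl , [] , q) (λ { ([] , _ , _ , q) → q }) (Q? [])
  any-phrases? N (suc m) Q? =
    map′ (λ { (ph , w , ps , refl , ws , q) → ph ∷ ps , refl , w ∷ ws , q })
         (λ { (ph ∷ ps , refl , w ∷ ws , q) → ph , w , ps , refl , ws , q })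
         (any-phrase? N λ ph → any-phrases? N m λ ps → Q? (ph ∷ ps))

  module _ {Q : List Phrase → Set} (Q? : ∀ ps → Dec (Q ps))
           (N : ℕ) (within : ∀ ps → Q ps → All (PhraseWithin N) ps) where

    minimum-size : ∀ ps → Q ps → Σ ℕ (IsMin λ m → Σ (List Phrase) λ ps → Q ps × length ps ≡ m)
    minimum-size ps q = least size? (length ps) (ps , q , refl)
      where
      size? : ∀ m → Dec (Σ (List Phrase) λ ps → Q ps × length ps ≡ m)
      size? m = map′ (λ { (ps , ≡m , _ , q) → ps , q , ≡m })
                     (λ { (ps , q , ≡m) → ps , ≡m , within ps q , q })
                     (any-phrases? N m Q?)

  literals : ℕ → List Phrase
  literals n = replicate n (phrase 1 nothing)

  literals-valid : ∀ {A : Set} (s : List A) a m → a + m ≡ length s → ValidFrom s a (literals m)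
  literals-valid s a zero    eq = trans (sym (+-identityʳ a)) eq
  literals-valid s a (suc m) eq = refl , literals-valid s (a + 1) m (trans (+-assoc a 1 m) eq)

  literals-¬SrcOf : ∀ {a m p q} → ¬ SrcOf a (literals m) p q
  literals-¬SrcOf {m = suc m} (there src) = literals-¬SrcOf src

  literals-BLZ : ∀ {A : Set} c (s : List A) → IsBLZ c s (literals (length s))
  literals-BLZ c s = literals-valid s 0 (length s) refl , hops
    where
    hops : ∀ p h → p < length s → Hop (literals (length s)) p h → h ≤ c
    hops p _ _ (last _)       = z≤n
    hops p _ _ (step _ src _) = contradiction src literals-¬SrcOf

  module _ {A : Set} (_≟A_ : DecidableEquality A) (s : List A) where

    OptLZ-exists : Σ ℕ (IsOptLZ s)
    OptLZ-exists = minimum-size (ValidFrom? _≟A_ s 0) (length s) (λ ps → ValidFrom⇒within ps)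
                                (literals (length s)) (literals-valid s 0 (length s) refl)

    OptBLZ-exists : ∀ c → Σ ℕ (IsOptBLZ c s)
    OptBLZ-exists c = minimum-size (λ ps → ValidFrom? _≟A_ s 0 ps ×-dec HopsBounded? c ps (length s))
                                   (length s) (λ ps blz → ValidFrom⇒within ps (proj₁ blz))
                                   (literals (length s)) (literals-BLZ c s)

  PhraseOK⇒positive : ∀ {A : Set} {s : List A} {a} ph → PhraseOK s a ph → 1 ≤ len ph
  PhraseOK⇒positive (phrase _ nothing)  refl        = ≤-refl
  PhraseOK⇒positive (phrase _ (just _)) (1≤ℓ , _) = 1≤ℓ

  SrcOf⇒≥ : ∀ {a ps p q} → SrcOf a ps p q → a ≤ p
  SrcOf⇒≥ (here {a} {t = t} _) = m≤m+n a t
  SrcOf⇒≥ {a} (there {ph = ph} src) = ≤-trans (m≤m+n a (len ph)) (SrcOf⇒≥ src)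

  last-position : ∀ a ℓ → a + suc ℓ ∸ 1 ≡ a + ℓ
  last-position a ℓ = cong (_∸ 1) (+-suc a ℓ)

  last-position< : ∀ a ℓ → 1 ≤ ℓ → a + ℓ ∸ 1 < a + ℓ
  last-position< a (suc ℓ) _ = ≤-reflexive (trans (cong suc (last-position a ℓ)) (sym (+-suc a ℓ)))

  IsLast⇒≥ : ∀ {A : Set} {s : List A} {a ps p} → ValidFrom s a ps → IsLast a ps p → a ≤ p
  IsLast⇒≥ {a = a} {ph ∷ _} (ok , _) here =
    ≤-trans (m≤m+n a (len ph ∸ 1)) (≤-reflexive (sym (+-∸-assoc a (PhraseOK⇒positive ph ok))))
  IsLast⇒≥ {a = a} {ph ∷ _} (_ , valid) (there l) = ≤-trans (m≤m+n a (len ph)) (IsLast⇒≥ valid l)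

  SrcOf⇒¬IsLast : ∀ {A : Set} {s : List A} {a ps p q} → ValidFrom s a ps → SrcOf a ps p q → ¬ IsLast a ps p
  SrcOf⇒¬IsLast valid src l = distinct valid src l refl
    where
    distinct : ∀ {A : Set} {s : List A} {a ps p p′ q} →
               ValidFrom s a ps → SrcOf a ps p q → IsLast a ps p′ → p ≢ p′
    distinct {a = a} _ (here {ℓ = suc ℓ} {t = t} (s≤s t<ℓ)) here p≡ =
      <-irrefl (trans p≡ (last-position a ℓ)) (+-monoʳ-< a t<ℓ)
    distinct {a = a} (_ , valid) (here {ℓ = ℓ} {t = t} t<ℓ) (there l) refl =
      <-irrefl refl (<-≤-trans (+-monoʳ-< a (<-trans (n<1+n t) t<ℓ)) (IsLast⇒≥ valid l))
    distinct {a = a} (ok , _) (there {ph = ph} src) here refl =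
      <-irrefl refl (<-≤-trans (last-position< a (len ph) (PhraseOK⇒positive ph ok)) (SrcOf⇒≥ src))
    distinct (_ , valid) (there src) (there l) = distinct valid src l

  IsLast⊎SrcOf : ∀ {A : Set} {s : List A} {a ps p} → ValidFrom s a ps → a ≤ p → p < length s →
            IsLast a ps p ⊎ ∃ (SrcOf a ps p)
  IsLast⊎SrcOf {a = a} {[]} refl a≤p p<N = ⊥-elim (<-irrefl refl (<-≤-trans p<N a≤p))
  IsLast⊎SrcOf {a = a} {phrase ℓ src ∷ ps} {p} (ok , valid) a≤p p<N with p <? a + ℓ
  ... | no p≮ with IsLast⊎SrcOf valid (≮⇒≥ p≮) p<N
  ...   | inj₁ l         = inj₁ (there l)
  ...   | inj₂ (q , src′) = inj₂ (q , there src′)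
  IsLast⊎SrcOf {a = a} {phrase ℓ src ∷ ps} (ok , valid) a≤p p<N | yes p< with m≤n⇒∃[o]m+o≡n a≤p
  ... | t , refl with suc t <? ℓ
  ...   | yes t+1<ℓ = inj₂ (copy src ok)
    where
    copy : ∀ src → PhraseOK _ a (phrase ℓ src) → ∃ (SrcOf a (phrase ℓ src ∷ ps) (a + t))
    copy nothing  refl          = ⊥-elim (n≮0 (≤-pred t+1<ℓ))
    copy (just b) (_ , b<a , _) = _ , here {{<⇒nonZero-∸ b<a}} t+1<ℓ
  ...   | no t+1≮ℓ = inj₁ (subst (IsLast a _) a+ℓ∸1≡a+t here)
    where
    ℓ≡ : ℓ ≡ suc t
    ℓ≡ = ≤-antisym (≮⇒≥ t+1≮ℓ) (+-cancelˡ-< a t ℓ p<)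
    a+ℓ∸1≡a+t : a + ℓ ∸ 1 ≡ a + t
    a+ℓ∸1≡a+t = trans (cong (λ ℓ → a + ℓ ∸ 1) ℓ≡) (last-position a t)

  module _ {A : Set} {s : List A} {ps : List Phrase} (lz : IsLZ s ps) where

    Hop-step : ∀ {p q h} → SrcOf 0 ps p q → Hop ps q h → Hop ps p (suc h)
    Hop-step src = step (SrcOf⇒¬IsLast lz src) src

    Hop-exists : ∀ p → p < length s → ∃ (Hop ps p)
    Hop-exists = <-rec (λ p → p < length s → ∃ (Hop ps p)) exists
      where
      exists : ∀ p → (∀ {q} → q < p → q < length s → ∃ (Hop ps q)) → p < length s → ∃ (Hop ps p)
      exists p rec p<N with IsLast⊎SrcOf lz z≤n p<N
      ... | inj₁ l = 0 , last l
      ... | inj₂ (q , src) with rec (SrcOf⇒< src) (<-trans (SrcOf⇒< src) p<N)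
      ...   | h , hop = suc h , Hop-step src hop

module Runs where

  open import Data.Nat using (ℕ; zero; suc; _+_; _*_; _<_; _≤_; _≤?_; z≤n; z<s)
  open import Data.Nat.Properties
  open import Data.Product using (_,_)
  open import Relation.Binary.PropositionalEquality
  open import Relation.Nullary using (yes; no; ¬_; contradiction)

  AllOn : (ℕ → Set) → ℕ → ℕ → Set
  AllOn R x L = ∀ i → i < L → R (x + i)

  AllOn-prefix : ∀ {R x} L₁ L₂ → AllOn R x (L₁ + L₂) → AllOn R x L₁
  AllOn-prefix L₁ L₂ all i i<L₁ = all i (<-≤-trans i<L₁ (m≤m+n L₁ L₂))

  AllOn-suffix : ∀ {R x} L₁ L₂ → AllOn R x (L₁ + L₂) → AllOn R (x + L₁) L₂
  AllOn-suffix {R} {x} L₁ L₂ all i i<L₂ =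
    subst R (sym (+-assoc x L₁ i)) (all (L₁ + i) (+-monoʳ-< L₁ i<L₂))

  record RunsBounded (R : ℕ → Set) (W x ℓ : ℕ) : Set where
    constructor runs-bounded
    field run≤ : ∀ u L → u + L ≤ ℓ → AllOn R (x + u) L → L ≤ W
  open RunsBounded public

  RunsBounded-window : ∀ {R x} ℓ → RunsBounded R ℓ x ℓ
  RunsBounded-window ℓ = runs-bounded λ u L u+L≤ℓ _ → ≤-trans (m≤n+m L u) u+L≤ℓ

  RunsBounded-empty : ∀ {R W x} → RunsBounded R W x 0
  RunsBounded-empty = runs-bounded λ u L u+L≤0 _ → ≤-trans (≤-trans (m≤n+m L u) u+L≤0) z≤n

  RunsBounded-none : ∀ {R x ℓ} → (∀ t → t < ℓ → ¬ R (x + t)) → RunsBounded R 0 x ℓ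
  RunsBounded-none {R} {x} {ℓ} none = runs-bounded bound
    where
    bound : ∀ u L → u + L ≤ ℓ → AllOn R (x + u) L → L ≤ 0
    bound u zero    _     _   = z≤n
    bound u (suc L) u+L≤ℓ all =
      contradiction (subst R (+-identityʳ (x + u)) (all 0 z<s)) (none u (<-≤-trans (m<m+n u z<s) u+L≤ℓ))

  RunsBounded-shrink : ∀ {R W x ℓ ℓ′} → ℓ′ ≤ ℓ → RunsBounded R W x ℓ → RunsBounded R W x ℓ′
  RunsBounded-shrink ℓ′≤ℓ bound =
    runs-bounded λ u L u+L≤ℓ′ → run≤ bound u L (≤-trans u+L≤ℓ′ ℓ′≤ℓ)

  RunsBounded-transport : ∀ {R R′ W x y ℓ} → (∀ t → t < ℓ → R (x + t) → R′ (y + t)) →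
                          RunsBounded R′ W y ℓ → RunsBounded R W x ℓ
  RunsBounded-transport {R} {R′} {x = x} {y} move bound = runs-bounded λ u L u+L≤ℓ all →
    run≤ bound u L u+L≤ℓ λ i i<L →
      subst R′ (sym (+-assoc y u i))
        (move (u + i) (<-≤-trans (+-monoʳ-< u i<L) u+L≤ℓ) (subst R (+-assoc x u i) (all i i<L)))

  RunsBounded-++ : ∀ {R W₁ W₂ x ℓ₁ ℓ₂} → RunsBounded R W₁ x ℓ₁ → RunsBounded R W₂ (x + ℓ₁) ℓ₂ →
                   RunsBounded R (W₁ + W₂) x (ℓ₁ + ℓ₂)
  RunsBounded-++ {R} {W₁} {W₂} {x} {ℓ₁} {ℓ₂} left right = runs-bounded runs
    where
    runs : ∀ u L → u + L ≤ ℓ₁ + ℓ₂ → AllOn R (x + u) L → L ≤ W₁ + W₂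
    runs u L u+L≤ with ℓ₁ ≤? u
    ... | yes ℓ₁≤u with m≤n⇒∃[o]m+o≡n {ℓ₁} {u} ℓ₁≤u
    ...   | u′ , refl = λ all →
      ≤-trans (run≤ right u′ L (+-cancelˡ-≤ ℓ₁ _ _ inside) (shift all)) (m≤n+m W₂ W₁)
      where
      inside : ℓ₁ + (u′ + L) ≤ ℓ₁ + ℓ₂
      inside = ≤-trans (≤-reflexive (sym (+-assoc ℓ₁ u′ L))) u+L≤
      shift : AllOn R (x + (ℓ₁ + u′)) L → AllOn R (x + ℓ₁ + u′) L
      shift = subst (λ y → AllOn R y L) (sym (+-assoc x ℓ₁ u′))
    runs u L u+L≤ | no ℓ₁≰u
      with m≤n⇒∃[o]m+o≡n {u} {ℓ₁} (<⇒≤ (≰⇒> ℓ₁≰u))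
    ... | m , refl with L ≤? m
    ...   | yes L≤m = λ all → ≤-trans (run≤ left u L (+-monoʳ-≤ u L≤m) all) (m≤m+n W₁ W₂)
    ...   | no L≰m with m≤n⇒∃[o]m+o≡n {m} {L} (<⇒≤ (≰⇒> L≰m))
    ...     | L₂ , refl = λ all →
      +-mono-≤ (run≤ left u m ≤-refl (AllOn-prefix {R} m L₂ all))
               (run≤ right 0 L₂ (+-cancelˡ-≤ (u + m) _ _ inside) (shift (AllOn-suffix {R} m L₂ all)))
      where
      inside : u + m + L₂ ≤ u + m + ℓ₂
      inside = ≤-trans (≤-reflexive (+-assoc u m L₂)) u+L≤
      shift : AllOn R (x + u + m) L₂ → AllOn R (x + (u + m) + 0) L₂
      shift = subst (λ y → AllOn R y L₂) (trans (+-assoc x u m) (sym (+-identityʳ _)))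

  RunsBounded-blocks : ∀ {R W} d → (∀ j → RunsBounded R W (j * d) d) →
                       ∀ k → RunsBounded R (k * W) 0 (k * d)
  RunsBounded-blocks d block zero = RunsBounded-empty
  RunsBounded-blocks {R} {W} d block (suc k) =
    subst₂ (λ W′ ℓ → RunsBounded R W′ 0 ℓ) (+-comm (k * W) W) (+-comm (k * d) d)
      (RunsBounded-++ (RunsBounded-blocks d block k) (block k))

module HopBound where

  open Parsings
  open Runs
  open import Data.Nat using (ℕ; zero; suc; _+_; _*_; _∸_; _<_; _≤_; s≤s; NonZero)
  open import Data.Nat.Properties
  open import Data.Nat.DivMod using (_%_; [m+kn]%n≡m%n; m<n⇒m%n≡m)
  open import Data.List using (List; []; _∷_; length)
  open import Data.Maybe using (just; nothing)
  open import Data.Product using (_,_; proj₁; proj₂)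
  open import Relation.Binary.PropositionalEquality
  open import Relation.Nullary using (¬_)

  -- The range condition matters: out of range, `at` agrees trivially on `nothing`.
  Aperiodic : {A : Set} → ℕ → List A → Set
  Aperiodic E s = ∀ b d L → 0 < d → b + d + L ≤ length s →
    (∀ i → i < L → s at (b + i) ≡ s at (b + d + i)) → L < E * d

  -- Each of the z phrases contributes its last position and, at level h + 1, at most E blocks of its
  -- interior, each mirroring a run of level h.
  maxRun : (E z h : ℕ) → ℕ
  maxRun E z zero    = z * 1
  maxRun E z (suc h) = z * (E * maxRun E z h + 1)

  module _ {A : Set} {s : List A} {ps : List Phrase} (lz : IsLZ s ps) where

    HopAtMost : ℕ → ℕ → Set
    HopAtMost h p = ∀ h′ → Hop ps p h′ → h′ ≤ h

    HopAtMost-source : ∀ {h p q} → SrcOf 0 ps p q → HopAtMost (suc h) p → HopAtMost h q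
    HopAtMost-source src atMost h′ hop = ≤-pred (atMost (suc h′) (Hop-step lz src hop))

    ¬HopAtMost-zero : ∀ {p q} → SrcOf 0 ps p q → p < length s → ¬ HopAtMost 0 p
    ¬HopAtMost-zero src p<N atMost with Hop-exists lz _ (<-trans (SrcOf⇒< src) p<N)
    ... | h , hop = n≮0 (atMost (suc h) (Hop-step lz src hop))

    data Suffix : ℕ → List Phrase → Set where
      whole : Suffix 0 ps
      drop  : ∀ {a ph rest} → Suffix a (ph ∷ rest) → Suffix (a + len ph) rest

    Suffix-valid : ∀ {a rest} → Suffix a rest → ValidFrom s a rest
    Suffix-valid whole      = lz
    Suffix-valid (drop suf) = proj₂ (Suffix-valid suf)

    Suffix-SrcOf : ∀ {a rest p q} → Suffix a rest → SrcOf a rest p q → SrcOf 0 ps p q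
    Suffix-SrcOf whole      src = src
    Suffix-SrcOf (drop suf) src = Suffix-SrcOf suf (there src)

    InteriorRuns : ℕ → ℕ → Set
    InteriorRuns h W = ∀ {a l b rest} → Suffix a (phrase (suc l) (just b) ∷ rest) →
                       RunsBounded (HopAtMost h) W a l

    module CopyPhrase {a l b rest} (suf : Suffix a (phrase (suc l) (just b) ∷ rest)) where

      b<a : b < a
      b<a = proj₁ (proj₂ (proj₁ (Suffix-valid suf)))

      d : ℕ
      d = a ∸ b

      instance
        d≢0 : NonZero d
        d≢0 = <⇒nonZero-∸ b<a

      b+d≡a : b + d ≡ a
      b+d≡a = m+[n∸m]≡n (<⇒≤ b<a)

      end≤N : a + suc l ≤ length s
      end≤N = ValidFrom⇒≤ rest (proj₂ (Suffix-valid suf))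

      source : ∀ {t} → t < l → SrcOf 0 ps (a + t) (b + t % d)
      source t<l = Suffix-SrcOf suf (here (s≤s t<l))

      interior<N : ∀ {t} → t < l → a + t < length s
      interior<N t<l = <-≤-trans (+-monoʳ-< a (<-trans t<l (n<1+n l))) end≤N

      b+d≤N : b + d ≤ length s
      b+d≤N = ≤-trans (≤-reflexive b+d≡a) (≤-trans (m≤m+n a (suc l)) end≤N)

      l<E*d : ∀ E → Aperiodic E s → l < E * d
      l<E*d E aperiodic = aperiodic b d l (m<n⇒0<n∸m b<a)
        (≤-trans (≤-reflexive (cong (_+ l) b+d≡a)) (≤-trans (+-monoʳ-≤ a (n≤1+n l)) end≤N))
        λ i i<l → trans (copies i (s≤s i<l)) (cong (λ x → s at (x + i)) (sym b+d≡a))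
        where
        copies : ∀ t → suc t < suc l → s at (b + t) ≡ s at (a + t)
        copies = proj₂ (proj₂ (proj₁ (Suffix-valid suf)))

    InteriorRuns-zero : InteriorRuns 0 0
    InteriorRuns-zero suf = RunsBounded-none λ t t<l → ¬HopAtMost-zero (source t<l) (interior<N t<l)
      where open CopyPhrase suf

    phrase-runs : ∀ {h W a ph rest} → InteriorRuns h W → Suffix a (ph ∷ rest) →
                  RunsBounded (HopAtMost h) (W + 1) a (len ph)
    phrase-runs {ph = phrase zero nothing}  _ suf with () ← proj₁ (Suffix-valid suf)
    phrase-runs {ph = phrase zero (just _)} _ suf with () , _ ← proj₁ (Suffix-valid suf)
    phrase-runs {a = a} {phrase (suc _) nothing} _ suf with refl ← proj₁ (Suffix-valid suf) =
      RunsBounded-++ RunsBounded-empty (RunsBounded-window {x = a + 0} 1)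
    phrase-runs {h} {W} {a} {phrase (suc l) (just _)} interior suf =
      subst (RunsBounded (HopAtMost h) (W + 1) a) (+-comm l 1) (RunsBounded-++ (interior suf) (RunsBounded-window 1))

    all-runs : ∀ {h W a rest} → InteriorRuns h W → Suffix a rest →
               RunsBounded (HopAtMost h) (length rest * (W + 1)) a (span rest)
    all-runs {rest = []}    interior suf = RunsBounded-empty
    all-runs {rest = _ ∷ _} interior suf = RunsBounded-++ (phrase-runs interior suf) (all-runs interior (drop suf))

    module _ {E} (aperiodic : Aperiodic E s) where

      -- On each block of d interior offsets, t ↦ b + t mod d is a shift into [b, a).
      InteriorRuns-suc : ∀ {h W} → RunsBounded (HopAtMost h) W 0 (length s) → InteriorRuns (suc h) (E * W)
      InteriorRuns-suc {h} {W} global {a} {l} {b} suf =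
        RunsBounded-transport (λ t t<l → HopAtMost-source (source t<l))
          (RunsBounded-shrink (<⇒≤ (l<E*d E aperiodic)) (RunsBounded-blocks d block E))
        where
        open CopyPhrase suf
        block : ∀ j → RunsBounded (λ t → HopAtMost h (b + t % d)) W (j * d) d
        block j = runs-bounded run
          where
          run : ∀ u L → u + L ≤ d → AllOn (λ t → HopAtMost h (b + t % d)) (j * d + u) L → L ≤ W
          run u L u+L≤d all = run≤ global (b + u) L in-source λ i i<L →
            subst (HopAtMost h) (offset i (<-≤-trans (+-monoʳ-< u i<L) u+L≤d)) (all i i<L)
            where
            in-source : b + u + L ≤ length s
            in-source = ≤-trans (≤-reflexive (+-assoc b u L)) (≤-trans (+-monoʳ-≤ b u+L≤d) b+d≤N)
            offset : ∀ i → u + i < d → b + (j * d + u + i) % d ≡ b + u + i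
            offset i u+i<d = begin
              b + (j * d + u + i) % d   ≡⟨ cong (λ x → b + x % d) (+-assoc (j * d) u i) ⟩
              b + (j * d + (u + i)) % d ≡⟨ cong (λ x → b + x % d) (+-comm (j * d) (u + i)) ⟩
              b + (u + i + j * d) % d   ≡⟨ cong (b +_) ([m+kn]%n≡m%n (u + i) j d) ⟩
              b + (u + i) % d           ≡⟨ cong (b +_) (m<n⇒m%n≡m u+i<d) ⟩
              b + (u + i)               ≡⟨ +-assoc b u i ⟨
              b + u + i                 ∎
              where open ≡-Reasoning

      runs-bound : ∀ h → RunsBounded (HopAtMost h) (maxRun E (length ps) h) 0 (length s)
      runs-bound h = subst (RunsBounded (HopAtMost h) _ 0) (ValidFrom⇒span ps lz) (span-bound h)
        where
        span-bound : ∀ h → RunsBounded (HopAtMost h) (maxRun E (length ps) h) 0 (span ps)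
        span-bound zero    = all-runs InteriorRuns-zero whole
        span-bound (suc h) = all-runs (InteriorRuns-suc (runs-bound h)) whole

      BLZ-length≤maxRun : ∀ {c} → HopsBounded c ps (length s) → length s ≤ maxRun E (length ps) c
      BLZ-length≤maxRun {c} bounded =
        run≤ (runs-bound c) 0 (length s) ≤-refl λ p p<N h hop → bounded p h p<N hop

module Growth where

  open HopBound using (maxRun)
  open import Data.Nat using (zero; suc; _+_; _*_; _∸_; _^_; _<_; _≤_; z≤n; s≤s; z<s)
  open import Data.Nat.Properties
  open import Data.Nat.Tactic.RingSolver using (solve-∀)
  open import Data.Product using (∃; _,_)
  open import Relation.Binary.PropositionalEquality

  n<2^n : ∀ n → n < 2 ^ n
  n<2^n zero    = z<s
  n<2^n (suc n) = ≤-<-trans (n<2^n n) (m<m+n (2 ^ n) (<-≤-trans (m^n>0 2 n) (m≤m+n (2 ^ n) 0)))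

  2[1+n]≤2^[1+n] : ∀ n → 2 * suc n ≤ 2 ^ suc n
  2[1+n]≤2^[1+n] zero    = ≤-refl
  2[1+n]≤2^[1+n] (suc n) = begin
    2 * suc (suc n)          ≡⟨ *-distribˡ-+ 2 1 (suc n) ⟩
    2 + 2 * suc n            ≤⟨ +-monoˡ-≤ (2 * suc n) (≤-trans (*-monoʳ-≤ 2 (s≤s z≤n)) ih) ⟩
    2 ^ suc n + 2 * suc n    ≤⟨ +-monoʳ-≤ (2 ^ suc n) (≤-trans ih (m≤m+n (2 ^ suc n) 0)) ⟩
    2 ^ suc (suc n)          ∎
    where
    open ≤-Reasoning
    ih = 2[1+n]≤2^[1+n] n

  linear<exp : ∀ C → ∃ λ r → C * suc r < 2 ^ r
  linear<exp C = k + k , (begin-strict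
    C * suc (k + k)          <⟨ m<m+n _ z<s ⟩
    C * suc (k + k) + suc slack ≡⟨ square C ⟩
    2 * k * (2 * k)          ≤⟨ *-mono-≤ (2[1+n]≤2^[1+n] C) (2[1+n]≤2^[1+n] C) ⟩
    2 ^ k * 2 ^ k            ≡⟨ ^-distribˡ-+-* 2 k k ⟨
    2 ^ (k + k)              ∎)
    where
    open ≤-Reasoning
    k = suc C
    slack = 2 * C * C + 5 * C + 3
    square : ∀ C → C * suc (suc C + suc C) + suc (2 * C * C + 5 * C + 3) ≡ 2 * suc C * (2 * suc C)
    square = solve-∀

  -- K = 2^r ∸ 1 turns C * suc K into C * 2^r ≤ 2^(C + r).
  poly≤exp : ∀ C p → ∃ λ K → (C * suc K) ^ p ≤ 2 ^ K
  poly≤exp C p with linear<exp (suc C * p)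
  ... | r , small = 2 ^ r ∸ 1 , (begin
    (C * suc (2 ^ r ∸ 1)) ^ p   ≡⟨ cong (λ n → (C * n) ^ p) 1+[2^r∸1]≡2^r ⟩
    (C * 2 ^ r) ^ p             ≤⟨ ^-monoˡ-≤ p (*-monoˡ-≤ (2 ^ r) (<⇒≤ (n<2^n C))) ⟩
    (2 ^ C * 2 ^ r) ^ p         ≡⟨ cong (_^ p) (^-distribˡ-+-* 2 C r) ⟨
    (2 ^ (C + r)) ^ p           ≡⟨ ^-*-assoc 2 (C + r) p ⟩
    2 ^ ((C + r) * p)           ≤⟨ ^-monoʳ-≤ 2 exponent≤ ⟩
    2 ^ (2 ^ r ∸ 1)             ∎)
    where
    open ≤-Reasoning
    1+[2^r∸1]≡2^r : suc (2 ^ r ∸ 1) ≡ 2 ^ r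
    1+[2^r∸1]≡2^r = m+[n∸m]≡n (m^n>0 2 r)
    expand : ∀ C r p → (C + r) * p + (C * r + 1) * p ≡ suc C * p * suc r
    expand = solve-∀
    exponent≤ : (C + r) * p ≤ 2 ^ r ∸ 1
    exponent≤ = ≤-pred (≤-trans (s≤s (≤-trans (m≤m+n _ _) (≤-reflexive (expand C r p))))
                                (≤-trans small (≤-reflexive (sym 1+[2^r∸1]≡2^r))))

  maxRun<pow : ∀ E z h → maxRun E z h < (suc E * suc z) ^ suc h
  maxRun<pow E z zero = begin-strict
    z * 1                  ≡⟨ *-identityʳ z ⟩
    z                      <⟨ n<1+n z ⟩
    suc z                  ≤⟨ m≤n*m (suc z) (suc E) ⟩
    suc E * suc z          ≡⟨ *-identityʳ _ ⟨
    (suc E * suc z) ^ 1    ∎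
    where open ≤-Reasoning
  maxRun<pow E z (suc h) = begin-strict
    z * (E * B + 1)            <⟨ +-monoˡ-≤ (z * (E * B + 1)) (m≤n+m 1 (E * B)) ⟩
    suc z * (E * B + 1)        ≤⟨ *-monoʳ-≤ (suc z) (≤-trans (E*B+1≤ E B) (*-monoʳ-≤ (suc E) B<P)) ⟩
    suc z * (suc E * P)        ≡⟨ regroup (suc z) (suc E) P ⟩
    suc E * suc z * P          ∎
    where
    open ≤-Reasoning
    B = maxRun E z h
    P = (suc E * suc z) ^ suc h
    B<P : B < P
    B<P = maxRun<pow E z h
    E*B+1≤ : ∀ E B → E * B + 1 ≤ suc E * suc B
    E*B+1≤ E B = ≤-trans (m≤m+n (E * B + 1) (E + B)) (≤-reflexive (expand E B))
      where
      expand : ∀ E B → E * B + 1 + (E + B) ≡ suc E * suc B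
      expand = solve-∀
    regroup : ∀ x y P → x * (y * P) ≡ y * x * P
    regroup = solve-∀

  maxRun-eventually< : ∀ E A c → ∃ λ K → ∀ z → z ≤ A * suc K → maxRun E z c < 2 ^ K
  maxRun-eventually< E A c = bounded (poly≤exp (suc E * suc A) (suc c))
    where
    bounded : (∃ λ K → (suc E * suc A * suc K) ^ suc c ≤ 2 ^ K) →
              ∃ λ K → ∀ z → z ≤ A * suc K → maxRun E z c < 2 ^ K
    bounded (K , poly≤) = K , λ z z≤ → begin-strict
      maxRun E z c                       <⟨ maxRun<pow E z c ⟩
      (suc E * suc z) ^ suc c            ≤⟨ ^-monoˡ-≤ (suc c) (*-monoʳ-≤ (suc E) (1+z≤ z z≤)) ⟩
      (suc E * (suc A * suc K)) ^ suc c  ≡⟨ cong (_^ suc c) (*-assoc (suc E) (suc A) (suc K)) ⟨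
      (suc E * suc A * suc K) ^ suc c    ≤⟨ poly≤ ⟩
      2 ^ K                              ∎
      where
      open ≤-Reasoning
      1+z≤ : ∀ z → z ≤ A * suc K → suc z ≤ suc A * suc K
      1+z≤ z z≤ = ≤-trans (s≤s z≤) (+-monoˡ-≤ (A * suc K) (s≤s z≤n))

module Ruler where

  open HopBound using (Aperiodic; maxRun; BLZ-length≤maxRun)
  open Growth using (maxRun-eventually<)
  open import Data.Nat using (ℕ; zero; suc; _+_; _*_; _∸_; _^_; _<_; _≤_; _≤?_; _<?_; z≤n; s≤s; z<s; NonZero; >-nonZero)
  open import Data.Nat.Properties
  open import Data.Nat.Induction using (<-rec)
  open import Data.Nat.DivMod using (_%_; _/_; _mod_; m%n<n; m≡m%n+[m/n]*n)
  open import Data.Nat.Tactic.RingSolver using (solve-∀)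
  open import Data.Fin using (Fin; toℕ)
  open import Data.Fin.Properties using (toℕ-fromℕ<)
  open import Data.List using (List; []; _∷_; length; applyUpTo)
  open import Data.List.Properties using (length-applyUpTo)
  open import Data.Maybe using (just; nothing)
  open import Data.Maybe.Properties using (just-injective)
  open import Data.Product using (∃; ∃₂; _×_; _,_; proj₁; proj₂)
  open import Data.Sum using (_⊎_; inj₁; inj₂)
  open import Function using (_∘_)
  open import Relation.Binary.PropositionalEquality
  open import Relation.Nullary using (¬_; yes; no; contradiction)

  even-or-odd : ∀ n → (∃ λ r → n ≡ 2 * r) ⊎ (∃ λ r → n ≡ suc (2 * r))
  even-or-odd zero = inj₁ (0 , refl)
  even-or-odd (suc n) with even-or-odd n
  ... | inj₁ (r , refl) = inj₂ (r , refl)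
  ... | inj₂ (r , refl) = inj₁ (suc r , cong suc (sym (+-suc r (r + 0))))

  odd-part : ∀ n → ∃₂ λ e r → suc n ≡ 2 ^ e * suc (2 * r)
  odd-part = <-rec _ split
    where
    split : ∀ n → (∀ {m} → m < n → ∃₂ λ e r → suc m ≡ 2 ^ e * suc (2 * r)) →
            ∃₂ λ e r → suc n ≡ 2 ^ e * suc (2 * r)
    split n rec with even-or-odd (suc n)
    ... | inj₂ (r , eq) = 0 , r , trans eq (sym (+-identityʳ _))
    ... | inj₁ (zero , ())
    ... | inj₁ (suc m , eq) with rec {m} m<n
      where
      m<n : m < n
      m<n = subst (m <_) (sym (suc-injective eq)) (m<m+n m z<s)
    ...   | e , r , eq′ = suc e , r , trans eq (trans (cong (2 *_) eq′) (sym (*-assoc 2 (2 ^ e) _)))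

  v2 : ℕ → ℕ
  v2 zero    = 0
  v2 (suc n) = proj₁ (odd-part n)

  odd-part-unique : ∀ e e′ r r′ → 2 ^ e * suc (2 * r) ≡ 2 ^ e′ * suc (2 * r′) → e ≡ e′
  odd-part-unique zero    zero     r r′ eq = refl
  odd-part-unique zero    (suc e′) r r′ eq =
    contradiction (trans (sym (*-assoc 2 (2 ^ e′) _)) (trans (sym eq) (*-identityˡ _)))
                  (even≢odd (2 ^ e′ * suc (2 * r′)) r)
  odd-part-unique (suc e) zero     r r′ eq =
    contradiction (trans (sym (*-assoc 2 (2 ^ e) _)) (trans eq (*-identityˡ _)))
                  (even≢odd (2 ^ e * suc (2 * r)) r′)
  odd-part-unique (suc e) (suc e′) r r′ eq = cong suc (odd-part-unique e e′ r r′ (*-cancelˡ-≡ _ _ 2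
    (trans (sym (*-assoc 2 (2 ^ e) _)) (trans eq (*-assoc 2 (2 ^ e′) _)))))

  odd-part-positive : ∀ e r → 0 < 2 ^ e * suc (2 * r)
  odd-part-positive e r = *-mono-< (m^n>0 2 e) z<s

  v2-odd-part : ∀ {n} e r → n ≡ 2 ^ e * suc (2 * r) → v2 n ≡ e
  v2-odd-part {zero}  e r eq = contradiction (sym eq) (>⇒≢ (odd-part-positive e r))
  v2-odd-part {suc n} e r eq with odd-part n
  ... | e′ , r′ , eq′ = odd-part-unique e′ e r′ r (trans (sym eq′) eq)

  v2-shift : ∀ k n → 0 < n → n < 2 ^ k → v2 (2 ^ k + n) ≡ v2 n
  v2-shift k (suc m) _ n<2^k with odd-part m
  ... | e , r , eq with e <? k
  ...   | no e≮k = contradiction n<2^k (≤⇒≯ (begin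
    2 ^ k               ≤⟨ ^-monoʳ-≤ 2 (≮⇒≥ e≮k) ⟩
    2 ^ e               ≤⟨ m≤m*n (2 ^ e) (suc (2 * r)) ⟩
    2 ^ e * suc (2 * r) ≡⟨ eq ⟨
    suc m               ∎))
    where open ≤-Reasoning
  ...   | yes e<k with m≤n⇒∃[o]m+o≡n {suc e} {k} e<k
  ...     | j , refl = v2-odd-part e (r + 2 ^ j) (begin
    2 ^ (suc e + j) + suc m                          ≡⟨ cong₂ _+_ (^-distribˡ-+-* 2 (suc e) j) eq ⟩
    2 * 2 ^ e * 2 ^ j + 2 ^ e * suc (2 * r)          ≡⟨ shifted (2 ^ e) (2 ^ j) r ⟩
    2 ^ e * suc (2 * (r + 2 ^ j))                    ∎)
    where
    open ≡-Reasoning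
    shifted : ∀ X Y r → 2 * X * Y + X * suc (2 * r) ≡ X * suc (2 * (r + Y))
    shifted = solve-∀

  next-multiple : ∀ P B .{{_ : NonZero B}} → P + (B ∸ P % B) ≡ suc (P / B) * B
  next-multiple P B = begin
    P + (B ∸ P % B)                 ≡⟨ cong (_+ (B ∸ P % B)) (trans (m≡m%n+[m/n]*n P B) (+-comm (P % B) _)) ⟩
    P / B * B + P % B + (B ∸ P % B) ≡⟨ +-assoc (P / B * B) (P % B) _ ⟩
    P / B * B + (P % B + (B ∸ P % B)) ≡⟨ cong (P / B * B +_) (m+[n∸m]≡n (<⇒≤ (m%n<n P B))) ⟩
    P / B * B + B                   ≡⟨ +-comm (P / B * B) B ⟩
    suc (P / B) * B                 ∎
    where open ≡-Reasoning

  -- With Q · 2^(e+2) the first multiple of 2^(e+2) above P, take P + i = Q · 2^(e+2) + d; then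
  -- P + i = 2^e (2(r + 2Q) + 1) and P + i + d = 2^(e+1) (2(r + Q) + 1).
  valuation-jump : ∀ P {d} e r → d ≡ 2 ^ e * suc (2 * r) →
                   ∃ λ i → i ≤ 5 * d × v2 (P + i) ≡ e × v2 (P + i + d) ≡ suc e
  valuation-jump P e r refl = (B ∸ P % B) + d , i≤5d ,
    v2-odd-part e (r + 2 * Q) (trans P+i≡ (once X Q r)) ,
    v2-odd-part (suc e) (r + Q) (trans (cong (_+ d) P+i≡) (twice X Q r))
    where
    X = 2 ^ e
    d = X * suc (2 * r)
    B = 4 * X
    instance
      _ : NonZero B
      _ = >-nonZero (*-monoʳ-< 4 (m^n>0 2 e))
    Q = suc (P / B)
    P+i≡ : P + (B ∸ P % B + d) ≡ Q * (4 * X) + d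
    P+i≡ = trans (sym (+-assoc P _ d)) (cong (_+ d) (next-multiple P B))
    once : ∀ X Q r → Q * (4 * X) + X * suc (2 * r) ≡ X * suc (2 * (r + 2 * Q))
    once = solve-∀
    twice : ∀ X Q r → Q * (4 * X) + X * suc (2 * r) + X * suc (2 * r) ≡ 2 * X * suc (2 * (r + Q))
    twice = solve-∀
    i≤5d : B ∸ P % B + d ≤ 5 * d
    i≤5d = begin
      B ∸ P % B + d ≤⟨ +-monoˡ-≤ d (m∸n≤m B (P % B)) ⟩
      4 * X + d     ≤⟨ +-monoˡ-≤ d (*-monoʳ-≤ 4 (m≤m*n X (suc (2 * r)))) ⟩
      4 * d + d     ≡⟨ +-comm (4 * d) d ⟩
      5 * d         ∎
      where open ≤-Reasoning

  n%3≢[1+n]%3 : ∀ n → n % 3 ≢ suc n % 3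
  n%3≢[1+n]%3 zero ()
  n%3≢[1+n]%3 (suc zero) ()
  n%3≢[1+n]%3 (suc (suc zero)) ()
  n%3≢[1+n]%3 (suc (suc (suc n))) = n%3≢[1+n]%3 n

  v2-aperiodic : ∀ P d L → 0 < d → (∀ i → i < L → v2 (P + i) % 3 ≡ v2 (P + i + d) % 3) → L < 6 * d
  v2-aperiodic P (suc d′) L _ periodic with 6 * suc d′ ≤? L
  ... | no 6d≰L = ≰⇒> 6d≰L
  ... | yes 6d≤L with odd-part d′
  ...   | e , r , eq with valuation-jump P e r eq
  ...     | i , i≤5d , v2≡e , v2≡1+e = contradiction
    (trans (cong (_% 3) (sym v2≡e)) (trans (periodic i i<L) (cong (_% 3) v2≡1+e)))
    (n%3≢[1+n]%3 e)
    where
    i<L : i < L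
    i<L = ≤-<-trans i≤5d (<-≤-trans (*-monoˡ-< (suc d′) (n<1+n 5)) 6d≤L)

  ruler : ℕ → Fin 3
  ruler n = v2 n mod 3

  ruler≡⇒v2%3≡ : ∀ {m n} → ruler m ≡ ruler n → v2 m % 3 ≡ v2 n % 3
  ruler≡⇒v2%3≡ {m} {n} eq =
    trans (sym (toℕ-fromℕ< (m%n<n (v2 m) 3))) (trans (cong toℕ eq) (toℕ-fromℕ< (m%n<n (v2 n) 3)))

  rulerWord : ℕ → List (Fin 3)
  rulerWord K = applyUpTo (ruler ∘ suc) (2 ^ K)

  length-rulerWord : ∀ K → length (rulerWord K) ≡ 2 ^ K
  length-rulerWord K = length-applyUpTo (ruler ∘ suc) (2 ^ K)

  applyUpTo-at : ∀ {A : Set} (f : ℕ → A) {n j} → j < n → applyUpTo f n at j ≡ just (f j)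
  applyUpTo-at f {suc n} {zero}  _         = refl
  applyUpTo-at f {suc n} {suc j} (s≤s j<n) = applyUpTo-at (f ∘ suc) j<n

  rulerWord-nonempty : ∀ K → rulerWord K ≢ []
  rulerWord-nonempty K eq = <⇒≢ (m^n>0 2 K) (sym (trans (sym (length-rulerWord K)) (cong length eq)))

  rulerWord-at : ∀ K {j} → j < 2 ^ K → rulerWord K at j ≡ just (ruler (suc j))
  rulerWord-at K = applyUpTo-at (ruler ∘ suc)

  rulerWord-aperiodic : ∀ K → Aperiodic 6 (rulerWord K)
  rulerWord-aperiodic K b d L 0<d inRange agree = v2-aperiodic (suc b) d L 0<d periodic
    where
    periodic : ∀ i → i < L → v2 (suc b + i) % 3 ≡ v2 (suc b + i + d) % 3
    periodic i i<L = ruler≡⇒v2%3≡ {suc (b + i)} {suc (b + i + d)} (just-injective (begin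
      just (ruler (suc (b + i)))     ≡⟨ rulerWord-at K (≤-<-trans (+-monoˡ-≤ i (m≤m+n b d)) b+d+i<N) ⟨
      rulerWord K at (b + i)         ≡⟨ agree i i<L ⟩
      rulerWord K at (b + d + i)     ≡⟨ rulerWord-at K b+d+i<N ⟩
      just (ruler (suc (b + d + i))) ≡⟨ cong (λ x → just (ruler (suc x))) (+-comm-middle b d i) ⟩
      just (ruler (suc (b + i + d))) ∎))
      where
      open ≡-Reasoning
      b+d+i<N : b + d + i < 2 ^ K
      b+d+i<N = <-≤-trans (+-monoʳ-< (b + d) i<L) (≤-trans inRange (≤-reflexive (length-rulerWord K)))
      +-comm-middle : ∀ x y z → x + y + z ≡ x + z + y
      +-comm-middle x y z = trans (+-assoc x y z) (trans (cong (x +_) (+-comm y z)) (sym (+-assoc x z y)))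

  doubling : ℕ → ℕ → List Phrase
  doubling k zero    = []
  doubling k (suc m) = phrase (2 ^ k) (just 0) ∷ doubling (suc k) m

  rulerParse : ℕ → List Phrase
  rulerParse K = phrase 1 nothing ∷ doubling 0 K

  length-rulerParse : ∀ K → length (rulerParse K) ≡ suc K
  length-rulerParse K = cong suc (length-doubling 0 K)
    where
    length-doubling : ∀ k m → length (doubling k m) ≡ m
    length-doubling k zero    = refl
    length-doubling k (suc m) = cong suc (length-doubling (suc k) m)

  2^k+2^k≡2^[1+k] : ∀ k → 2 ^ k + 2 ^ k ≡ 2 ^ suc k
  2^k+2^k≡2^[1+k] k = cong (2 ^ k +_) (sym (+-identityʳ (2 ^ k)))

  doubling-valid : ∀ K k m → k + m ≡ K → ValidFrom (rulerWord K) (2 ^ k) (doubling k m)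
  doubling-valid K k zero refl =
    sym (trans (length-rulerWord (k + 0)) (cong (2 ^_) (+-identityʳ k)))
  doubling-valid K k (suc m) refl =
    (m^n>0 2 k , m^n>0 2 k , agree) ,
    subst (λ a → ValidFrom (rulerWord K) a (doubling (suc k) m)) (sym (2^k+2^k≡2^[1+k] k))
          (doubling-valid K (suc k) m (sym (+-suc k m)))
    where
    2^[1+k]≤N : 2 ^ suc k ≤ 2 ^ K
    2^[1+k]≤N = ^-monoʳ-≤ 2 (≤-trans (s≤s (m≤m+n k m)) (≤-reflexive (sym (+-suc k m))))
    agree : ∀ t → suc t < 2 ^ k → rulerWord K at (0 + t) ≡ rulerWord K at (2 ^ k + t)
    agree t t+1<2^k = begin
      rulerWord K at t                  ≡⟨ rulerWord-at K (<-≤-trans t<2^k (≤-trans (m≤m+n _ _) 2^k+2^k≤N)) ⟩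
      just (ruler (suc t))              ≡⟨ cong (λ n → just (n mod 3)) (v2-shift k (suc t) z<s t+1<2^k) ⟨
      just (ruler (2 ^ k + suc t))      ≡⟨ cong (just ∘ ruler) (+-suc (2 ^ k) t) ⟩
      just (ruler (suc (2 ^ k + t)))    ≡⟨ rulerWord-at K (<-≤-trans (+-monoʳ-< (2 ^ k) t<2^k) 2^k+2^k≤N) ⟨
      rulerWord K at (2 ^ k + t)        ∎
      where
      open ≡-Reasoning
      t<2^k : t < 2 ^ k
      t<2^k = <-trans (n<1+n t) t+1<2^k
      2^k+2^k≤N : 2 ^ k + 2 ^ k ≤ 2 ^ K
      2^k+2^k≤N = ≤-trans (≤-reflexive (2^k+2^k≡2^[1+k] k)) 2^[1+k]≤N

  rulerParse-LZ : ∀ K → IsLZ (rulerWord K) (rulerParse K)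
  rulerParse-LZ K = refl , doubling-valid K 0 K refl

  ruler-separates : ∀ c A → ∃ λ K →
                    ∀ {a b} → IsOptLZ (rulerWord K) a → IsOptBLZ c (rulerWord K) b → A * a < b
  ruler-separates c A = separated (maxRun-eventually< 6 A c)
    where
    separated : (∃ λ K → ∀ z → z ≤ A * suc K → maxRun 6 z c < 2 ^ K) →
                ∃ λ K → ∀ {a b} → IsOptLZ (rulerWord K) a → IsOptBLZ c (rulerWord K) b → A * a < b
    separated (K , small) = K , separation
      where
      separation : ∀ {a b} → IsOptLZ (rulerWord K) a → IsOptBLZ c (rulerWord K) b → A * a < b
      separation {a} (_ , a-min) ((ps , blz , refl) , _) =
        ≰⇒> λ b≤A*a → <⇒≱ (small (length ps) (≤-trans b≤A*a (*-monoʳ-≤ A a≤1+K))) 2^K≤maxRun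
        where
        a≤1+K : a ≤ suc K
        a≤1+K = a-min (suc K) (rulerParse K , rulerParse-LZ K , length-rulerParse K)
        2^K≤maxRun : 2 ^ K ≤ maxRun 6 (length ps) c
        2^K≤maxRun = subst (_≤ maxRun 6 (length ps) c) (length-rulerWord K)
                           (BLZ-length≤maxRun (proj₁ blz) (rulerWord-aperiodic K) (proj₂ blz))

open Parsings using (OptLZ-exists; OptBLZ-exists)
open Ruler using (rulerWord; rulerWord-nonempty; ruler-separates)
import Data.Nat as ℕ
open import Data.Nat using (ℕ; suc; _≤_)
open import Data.Nat.Properties using (≤-trans; ≤-reflexive; m≤m*n; *-identityʳ; *-monoˡ-<)
import Data.Nat.Coprimality as Coprimality
open import Data.Fin using (Fin)
open import Data.Fin.Properties using (_≟_)
open import Data.List using (List; [])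
open import Data.Product using (Σ; _×_; ∃; _,_)
open import Data.Integer using (+_; -[1+_]; +≤+; -≤+; +<+)
import Data.Integer as ℤ
import Data.Integer.Properties as ℤ
open import Data.Rational using (ℚ; mkℚ; _/_; _*_; _<_; *≤*; *<*)
import Data.Rational as ℚ
open import Data.Rational.Properties using (normalize-coprime; normalize-nonNeg; *-monoʳ-≤-nonNeg; ≤-<-trans)
open import Relation.Binary.PropositionalEquality

ℕ/1≡mkℚ : ∀ n → (+ n) / 1 ≡ mkℚ (+ n) 0 (Coprimality.sym (Coprimality.1-coprimeTo n))
ℕ/1≡mkℚ n = normalize-coprime (Coprimality.sym (Coprimality.1-coprimeTo n))

ℕ/1-mono-< : ∀ {m n} → m ℕ.< n → (+ m) / 1 < (+ n) / 1
ℕ/1-mono-< {m} {n} m<n rewrite ℕ/1≡mkℚ m | ℕ/1≡mkℚ n =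
  *<* (subst₂ ℤ._<_ (ℤ.pos-* m 1) (ℤ.pos-* n 1) (+<+ (*-monoˡ-< 1 m<n)))

ℕ/1-* : ∀ m n → (+ m) / 1 * ((+ n) / 1) ≡ (+ (m ℕ.* n)) / 1
ℕ/1-* m n rewrite ℕ/1≡mkℚ m | ℕ/1≡mkℚ n = cong (_/ 1) (sym (ℤ.pos-* m n))

≤-ℕ/1 : ∀ M → ∃ λ A → M ℚ.≤ (+ A) / 1
≤-ℕ/1 (mkℚ (+ n) d c) = n , subst (mkℚ (+ n) d c ℚ.≤_) (sym (ℕ/1≡mkℚ n))
  (*≤* (subst₂ ℤ._≤_ (ℤ.pos-* n 1) (ℤ.pos-* n (suc d))
    (+≤+ (≤-trans (≤-reflexive (*-identityʳ n)) (m≤m*n n (suc d))))))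
≤-ℕ/1 (mkℚ -[1+ n ] d c) = 0 , subst (mkℚ -[1+ n ] d c ℚ.≤_) (sym (ℕ/1≡mkℚ 0)) (*≤* -≤+)

scale< : ∀ {M A a b} → M ℚ.≤ (+ A) / 1 → A ℕ.* a ℕ.< b → M * ((+ a) / 1) < (+ b) / 1
scale< {A = A} {a} {b} M≤A A*a<b = ≤-<-trans (*-monoʳ-≤-nonNeg ((+ a) / 1) {{normalize-nonNeg a 1}} M≤A)
  (subst (_< (+ b) / 1) (sym (ℕ/1-* A a)) (ℕ/1-mono-< A*a<b))

theorem5 : (c : ℕ) → 1 ≤ c → (M : ℚ) →
    Σ (List (Fin 3)) λ s → (s ≢ []) × Σ ℕ λ a → Σ ℕ λ b →
    IsOptLZ s a × IsOptBLZ c s b × (M * ((+ a) / 1) < (+ b) / 1)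
theorem5 c _ M =
  let A , M≤A       = ≤-ℕ/1 M
      K , separates = ruler-separates c A
      s             = rulerWord K
      a , optLZ     = OptLZ-exists _≟_ s
      b , optBLZ    = OptBLZ-exists _≟_ s c
  in s , rulerWord-nonempty K , a , b , optLZ , optBLZ , scale< {A = A} M≤A (separates optLZ optBLZ)
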